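{- Let $I$ be a model of a simple program $\mathcal H$ and let $K\subseteq I$ be such that there are no FT-critical edges in the subgraph of the dependency graph of $\mathcal H$ induced by $K$. If $I\models\mathcal H^K_\bot$, then $I\setminus K$ satisfies the FLP-reduct $FLP(\mathcal H,I)$.
   Context: Infinitary propositional formulas over a signature $\sigma$ are built from atoms via arbitrary conjunctions $\mathcal H^\land$, disjunctions $\mathcal H^\lor$ and implications; $\top,\bot$ are the empty conjunction and disjunction, $\neg F=F\to\bot$; interpretations are sets of atoms with the usual satisfaction. Extended literals: $p,\neg p,\neg\neg p$. A simple disjunction is a disjunction of extended literals; a simple implication is $\mathcal A^\land\to\mathcal L^\lor$ with $\mathcal A$ a set of atoms and $\mathcal L^\lor$ a simple disjunction; it is positive if $\mathcal L$ is a set of atoms and non-positive otherwise. A simple formula is a conjunction of simple implications; a simple rule is $G\to H$ with $G$ a simple formula and $H$ a disjunction of atoms; a simple program is a set of simple rules. An atom $q$ occurs strictly positively in a simple formula $G$ if $q\in\mathcal L$ for some conjunctive term $\mathcal A^\land\to\mathcal L^\lor$ of $G$, and occurs positively if $q$ or $\neg\neg q$ belongs to such an $\mathcal L$. The dependency graph of $\mathcal H$ has the atoms occurring in $\mathcal H$ as vertices and an edge $p\to q$ if for some $G\to H\in\mathcal H$, $p$ is a disjunctive term of $H$ and $q$ occurs positively in $G$; the edge is FT-critical if for some $G\to H\in\mathcal H$, $p$ is a disjunctive term of $H$ and $q$ occurs strictly positively in some non-positive conjunctive term of $G$. The FLP-reduct $FLP(\mathcal H,I)$ is the set of rules $G\to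 H\in\mathcal H$ with $I\models G$. For a set $X$ of atoms: for a simple disjunction $F$, $F^X_\bot$ removes all disjunctive terms that belong to $X$; for a simple implication $F=\mathcal A^\land\to\mathcal L^\lor$, $F^X_\bot$ is $F$ if $\mathcal A\cap X\neq\emptyset$ and $\mathcal A^\land\to(\mathcal L^\lor)^X_\bot$ otherwise; for simple formulas it is applied to each conjunctive term; $\mathcal H^X_\bot$ replaces each $G\to H$ by $G^X_\bot\to H^X_\bot$. -}

module Defs where

open import Data.Product using (Σ; Σ-syntax; _×_; _,_; ∃)
open import Data.Empty using (⊥)
open import Data.Unit using (⊤)
open import Relation.Nullary using (¬_; yes; no)
open import Relation.Binary.PropositionalEquality using (_≡_)
open import Axiom.ExcludedMiddle using (ExcludedMiddle)
open import Level using (0ℓ)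

-- Infinitary sets/families are represented by an index type in Set
-- together with a family; atoms of the signature σ form a type Atom.

AtomSet : Set → Set₁
AtomSet Atom = Atom → Set

_∖_ : {Atom : Set} → AtomSet Atom → AtomSet Atom → AtomSet Atom
(I ∖ K) a = I a × ¬ K a

_⊆_ : {Atom : Set} → AtomSet Atom → AtomSet Atom → Set
K ⊆ I = ∀ a → K a → I a

data ExtLit (Atom : Set) : Set where
  pos    : Atom → ExtLit Atom
  neg    : Atom → ExtLit Atom
  negneg : Atom → ExtLit Atom

record SimpleDisj (Atom : Set) : Set₁ where
  constructor disj
  field
    Idx : Set
    lit : Idx → ExtLit Atom
open SimpleDisj public

record SimpleImp (Atom : Set) : Set₁ where
  constructor _⇒_
  field
    body : Σ Set (λ J → J → Atom)
    head : SimpleDisj Atom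
open SimpleImp public

record SimpleFormula (Atom : Set) : Set₁ where
  constructor conj
  field
    TIdx : Set
    term : TIdx → SimpleImp Atom
open SimpleFormula public

record AtomDisj (Atom : Set) : Set₁ where
  constructor adisj
  field
    HIdx : Set
    atm  : HIdx → Atom
open AtomDisj public

record SimpleRule (Atom : Set) : Set₁ where
  constructor _←_
  field
    rhead : AtomDisj Atom
    rbody : SimpleFormula Atom
open SimpleRule public

record SimpleProgram (Atom : Set) : Set₁ where
  constructor prog
  field
    RIdx : Set
    rule : RIdx → SimpleRule Atom
open SimpleProgram public

module _ {Atom : Set} where

  ⊨lit : AtomSet Atom → ExtLit Atom → Set
  ⊨lit I (pos p)    = I p
  ⊨lit I (neg p)    = ¬ I p
  ⊨lit I (negneg p) = ¬ ¬ I p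

  ⊨disj : AtomSet Atom → SimpleDisj Atom → Set
  ⊨disj I L = Σ (Idx L) (λ j → ⊨lit I (lit L j))

  ⊨imp : AtomSet Atom → SimpleImp Atom → Set
  ⊨imp I (( J , A ) ⇒ L) = (∀ j → I (A j)) → ⊨disj I L

  ⊨formula : AtomSet Atom → SimpleFormula Atom → Set
  ⊨formula I G = ∀ t → ⊨imp I (term G t)

  ⊨adisj : AtomSet Atom → AtomDisj Atom → Set
  ⊨adisj I H = Σ (HIdx H) (λ j → I (atm H j))

  ⊨rule : AtomSet Atom → SimpleRule Atom → Set
  ⊨rule I r = ⊨formula I (rbody r) → ⊨adisj I (rhead r)

  ⊨prog : AtomSet Atom → SimpleProgram Atom → Set
  ⊨prog I 𝓗 = ∀ r → ⊨rule I (rule 𝓗 r)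

  FLP : SimpleProgram Atom → AtomSet Atom → SimpleProgram Atom
  FLP 𝓗 I = prog (Σ (RIdx 𝓗) (λ r → ⊨formula I (rbody (rule 𝓗 r))))
                 (λ { (r , _) → rule 𝓗 r })

  AtomIn : Atom → SimpleDisj Atom → Set
  AtomIn q L = Σ (Idx L) (λ j → lit L j ≡ pos q)

  IsAtomLit : ExtLit Atom → Set
  IsAtomLit (pos _)    = ⊤
  IsAtomLit (neg _)    = ⊥
  IsAtomLit (negneg _) = ⊥

  PositiveImp : SimpleImp Atom → Set
  PositiveImp (_ ⇒ L) = ∀ j → IsAtomLit (lit L j)

  StrictlyPositiveIn : Atom → SimpleFormula Atom → Set
  StrictlyPositiveIn q G = Σ (TIdx G) (λ t → AtomIn q (head (term G t)))

  PositiveIn : Atom → SimpleFormula Atom → Set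
  PositiveIn q G = Σ (TIdx G) (λ t →
    Σ (Idx (head (term G t))) (λ j →
      (lit (head (term G t)) j ≡ pos q) ⊎' (lit (head (term G t)) j ≡ negneg q)))
    where
      open import Data.Sum renaming (_⊎_ to _⊎'_)

  InHead : Atom → AtomDisj Atom → Set
  InHead p H = Σ (HIdx H) (λ j → atm H j ≡ p)

  Edge : SimpleProgram Atom → Atom → Atom → Set
  Edge 𝓗 p q = Σ (RIdx 𝓗) (λ r →
    InHead p (rhead (rule 𝓗 r)) × PositiveIn q (rbody (rule 𝓗 r)))

  FTCritical : SimpleProgram Atom → Atom → Atom → Set
  FTCritical 𝓗 p q = Σ (RIdx 𝓗) (λ r →
    InHead p (rhead (rule 𝓗 r)) ×
    Σ (TIdx (rbody (rule 𝓗 r))) (λ t →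
      ¬ PositiveImp (term (rbody (rule 𝓗 r)) t) ×
      AtomIn q (head (term (rbody (rule 𝓗 r)) t))))

  NoFTCriticalIn : SimpleProgram Atom → AtomSet Atom → Set
  NoFTCriticalIn 𝓗 K = ∀ p q → K p → K q → ¬ FTCritical 𝓗 p q

  -- The reduct ·^X_⊥ (the case split "𝓐 ∩ X ≠ ∅" is classical, so it
  -- is performed with an excluded-middle oracle)

  InX : AtomSet Atom → ExtLit Atom → Set
  InX X (pos p)    = X p
  InX X (neg _)    = ⊥
  InX X (negneg _) = ⊥

  disj⊥ : AtomSet Atom → SimpleDisj Atom → SimpleDisj Atom
  disj⊥ X L = disj (Σ (Idx L) (λ j → ¬ InX X (lit L j))) (λ { (j , _) → lit L j })

  imp⊥ : ExcludedMiddle 0ℓ → AtomSet Atom → SimpleImp Atom → SimpleImp Atom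
  imp⊥ em X ((J , A) ⇒ L) with em {¬ ((j : J) → ¬ X (A j))}
  ... | yes _ = (J , A) ⇒ L
  ... | no  _ = (J , A) ⇒ disj⊥ X L

  formula⊥ : ExcludedMiddle 0ℓ → AtomSet Atom → SimpleFormula Atom → SimpleFormula Atom
  formula⊥ em X G = conj (TIdx G) (λ t → imp⊥ em X (term G t))

  adisj⊥ : AtomSet Atom → AtomDisj Atom → AtomDisj Atom
  adisj⊥ X H = adisj (Σ (HIdx H) (λ j → ¬ X (atm H j))) (λ { (j , _) → atm H j })

  rule⊥ : ExcludedMiddle 0ℓ → AtomSet Atom → SimpleRule Atom → SimpleRule Atom
  rule⊥ em X (H ← G) = adisj⊥ X H ← formula⊥ em X G

  prog⊥ : ExcludedMiddle 0ℓ → AtomSet Atom → SimpleProgram Atom → SimpleProgram Atom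
  prog⊥ em X 𝓗 = prog (RIdx 𝓗) (λ r → rule⊥ em X (rule 𝓗 r))

-- Fix a rule G → H of the reduct, so I ⊨ G and I ∖ K ⊨ G, and suppose no
-- atom of H lies in I ∖ K. Since I ⊨ 𝓗, some atom p of H lies in I, hence
-- in K. We show I ⊨ G^K_⊥ term by term; then I ⊨ H^K_⊥ yields an atom of H
-- in I outside K, a contradiction. A term 𝓐^∧ → 𝓛^∨ with 𝓐 ∩ K ≠ ∅ is
-- unchanged. Otherwise 𝓐 ⊆ I ∖ K, so I ∖ K ⊨ 𝓛^∨: if the term is positive,
-- the true atom lies in I ∖ K and survives the reduct; if it is not, the
-- absence of FT-critical edges out of p keeps every atom of 𝓛 outside K,
-- so the reduct does not touch 𝓛 and I ⊨ 𝓛^∨ suffices.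
{-# OPTIONS --safe #-}
module Submission where

open import Defs
open import Axiom.ExcludedMiddle using (ExcludedMiddle)
open import Level using (0ℓ)
open import Data.Product using (_×_; _,_)
open import Relation.Nullary using (¬_; yes; no)
open import Relation.Nullary.Decidable using (decidable-stable)
open import Relation.Binary.PropositionalEquality using (refl)

module _ {Atom : Set} where

  StrictlyPositiveAvoids : AtomSet Atom → SimpleImp Atom → Set
  StrictlyPositiveAvoids K F = ∀ q → AtomIn q (head F) → ¬ K q

  NonPositiveTermsAvoid : AtomSet Atom → SimpleFormula Atom → Set
  NonPositiveTermsAvoid K G =
    ∀ t → ¬ PositiveImp (term G t) → StrictlyPositiveAvoids K (term G t)

  noFTCritical⇒nonPositiveTermsAvoid :
    ∀ 𝓗 {K p} r → NoFTCriticalIn 𝓗 K → K p → InHead p (rhead (rule 𝓗 r))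
    → NonPositiveTermsAvoid K (rbody (rule 𝓗 r))
  noFTCritical⇒nonPositiveTermsAvoid 𝓗 {p = p} r noFT Kp p∈H t ¬pos q q∈L Kq =
    noFT p q Kp Kq (r , p∈H , t , ¬pos , q∈L)

module _ {Atom : Set} (I K : AtomSet Atom) where

  atomLit-sat∖ : ∀ l → IsAtomLit l → ⊨lit (I ∖ K) l → ¬ InX K l × ⊨lit I l
  atomLit-sat∖ (pos q) _ (Iq , ¬Kq) = ¬Kq , Iq

  sat-disj⊥-positive : (L : SimpleDisj Atom) → (∀ j → IsAtomLit (lit L j))
                     → ⊨disj (I ∖ K) L → ⊨disj I (disj⊥ K L)
  sat-disj⊥-positive L atoms (j , s) with atomLit-sat∖ (lit L j) (atoms j) s
  ... | ¬Kl , Il = (j , ¬Kl) , Il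

  avoids⇒¬InX : (F : SimpleImp Atom) → StrictlyPositiveAvoids K F
              → ∀ j → ¬ InX K (lit (head F) j)
  avoids⇒¬InX F avoid j with lit (head F) j in eq
  ... | pos q = avoid q (j , eq)

  sat-disj⊥-avoiding : (F : SimpleImp Atom) → StrictlyPositiveAvoids K F
                     → ⊨disj I (head F) → ⊨disj I (disj⊥ K (head F))
  sat-disj⊥-avoiding F avoid (j , s) = (j , avoids⇒¬InX F avoid j) , s

  module _ (em : ExcludedMiddle 0ℓ) where

    sat-imp⊥ : (F : SimpleImp Atom) → ⊨imp I F → ⊨imp (I ∖ K) F
             → (¬ PositiveImp F → StrictlyPositiveAvoids K F)
             → ⊨imp I (imp⊥ em K F)
    sat-imp⊥ ((J , A) ⇒ L) I⊨F I∖K⊨F avoid with em {¬ ((j : J) → ¬ K (A j))}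
    ... | yes _ = I⊨F
    ... | no ¬meets = λ I⊨A → sat-head (I∖K⊨F (λ j → I⊨A j , ¬K j)) (I⊨F I⊨A)
      where
        ¬K : ∀ j → ¬ K (A j)
        ¬K j Kj = ¬meets (λ disjoint → disjoint j Kj)

        sat-head : ⊨disj (I ∖ K) L → ⊨disj I L → ⊨disj I (disj⊥ K L)
        sat-head I∖K⊨L I⊨L with em {PositiveImp ((J , A) ⇒ L)}
        ... | yes atoms = sat-disj⊥-positive L atoms I∖K⊨L
        ... | no ¬atoms = sat-disj⊥-avoiding ((J , A) ⇒ L) (avoid ¬atoms) I⊨L

    sat-formula⊥ : (G : SimpleFormula Atom) → ⊨formula I G → ⊨formula (I ∖ K) G
                 → NonPositiveTermsAvoid K G → ⊨formula I (formula⊥ em K G)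
    sat-formula⊥ G I⊨G I∖K⊨G avoid t = sat-imp⊥ (term G t) (I⊨G t) (I∖K⊨G t) (avoid t)

  sat-adisj⊥ : (H : AtomDisj Atom) → ⊨adisj I (adisj⊥ K H) → ⊨adisj (I ∖ K) H
  sat-adisj⊥ H ((j , ¬Kj) , Ij) = j , Ij , ¬Kj

lemma2 : (em : ExcludedMiddle 0ℓ) → {Atom : Set} → (𝓗 : SimpleProgram Atom)
    → (I K : AtomSet Atom) → ⊨prog I 𝓗 → K ⊆ I → NoFTCriticalIn 𝓗 K
    → ⊨prog I (prog⊥ em K 𝓗) → ⊨prog (I ∖ K) (FLP 𝓗 I)
lemma2 em 𝓗 I K I⊨𝓗 _ noFT I⊨𝓗⊥ (r , I⊨G) I∖K⊨G
  with em {⊨adisj (I ∖ K) (rhead (rule 𝓗 r))}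
... | yes I∖K⊨H = I∖K⊨H
... | no I∖K⊭H with I⊨𝓗 r I⊨G
...   | j , Ip = sat-adisj⊥ I K H (I⊨𝓗⊥ r I⊨G⊥)
  where
    H = rhead (rule 𝓗 r)
    G = rbody (rule 𝓗 r)

    Kp : K (atm H j)
    Kp = decidable-stable em (λ ¬Kp → I∖K⊭H (j , Ip , ¬Kp))

    I⊨G⊥ : ⊨formula I (formula⊥ em K G)
    I⊨G⊥ = sat-formula⊥ I K em G I⊨G I∖K⊨G
             (noFTCritical⇒nonPositiveTermsAvoid 𝓗 r noFT Kp (j , refl))
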